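{- Let $(X,A,f,\alpha)$ be a micro-macro dynamical system. Then (1) $\displaystyle \frac{|D|}{|X|}=\sum_{S(a)<S(b)}T_{ab}\,p_b,\qquad \frac{|I|}{|X|}=\sum_{S(a)>S(b)}T_{ab}\,p_b,\qquad \frac{|C|}{|X|}=\sum_{S(a)=S(b)}T_{ab}\,p_b$, where the sums run over pairs $(a,b)\in A\times A$; (2) $(X,A,f,\alpha)$ satisfies property $\mathrm{L}_1(\varepsilon)$ if and only if $\sum_{S(a)<S(b)}T_{ab}p_b\le\varepsilon$; (3) if $T_{ab}\le \dfrac{\varepsilon}{|A_{<b}|}$ for all $a,b\in A$ with $|a|<|b|$, then $(X,A,f,\alpha)$ satisfies property $\mathrm{L}_1(\varepsilon)$.
   Context: A micro-macro dynamical system is a tuple $(X,A,f,\alpha)$ where $X$ (microstates) and $A$ (macrostates) are finite sets, $f:X\to A$ is surjective and $\alpha:X\to X$ is a map. For $a\in A$ put $|a|=|f^{ -1}(a)|$, and for $i\in X$ put $|i|=|f(i)|$. Boltzmann entropy: $S(a)=\ln|a|$, $S(i)=\ln|i|$. Let $p_a=|a|/|X|$ and $T_{ab}=|\{i\in f^{ -1}(b): \alpha(i)\in f^{ -1}(a)\}|/|b|$. Let $D=\{i\in X: S(\alpha(i))<S(i)\}$, $I=\{i\in X: S(\alpha(i))>S(i)\}$, $C=\{i\in X:S(\alpha(i))=S(i)\}$. For $b\in A$, $A_{<b}=\{a\in A: |a|<|b|\}$. For $\varepsilon\in[0,1]$, the system satisfies property $\mathrm{L}_1(\varepsilon)$ if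 $|D|/|X|\le\varepsilon$.
   Formalization: The parameter ε ranges over the rationals in [0,1] rather than over all reals in [0,1]. -}

module Defs where

open import Data.Nat as ℕ using (ℕ; zero; suc; _<?_)
open import Data.Integer using (+_)
open import Data.Rational using (ℚ; 0ℚ; _/_; _+_; _*_; _≤_)
open import Data.Fin using (Fin; _≟_)
open import Data.List using (List; length; filter; foldr; map; allFin; cartesianProduct)
open import Data.Product using (_×_; _,_; ∃; proj₁; proj₂)
open import Relation.Nullary.Decidable using (_×-dec_)
open import Relation.Binary.PropositionalEquality using (_≡_)

-- Division of naturals into ℚ; junk value 0 when the denominator is 0
-- (never used with a zero denominator in the theorem).
frac : ℕ → ℕ → ℚ
frac k zero    = 0ℚ
frac k (suc d) = (+ k) / suc d

-- q / d for q ∈ ℚ, d ∈ ℕ; junk value 0 when d = 0.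
divℕ : ℚ → ℕ → ℚ
divℕ q zero    = 0ℚ
divℕ q (suc d) = q * ((+ 1) / suc d)

sumℚ : List ℚ → ℚ
sumℚ = foldr _+_ 0ℚ

-- A micro-macro dynamical system: X = Fin n, A = Fin m,
-- f : X → A surjective, α : X → X.
Surjective : ∀ {n m} → (Fin n → Fin m) → Set
Surjective {n} {m} f = ∀ (a : Fin m) → ∃ λ (i : Fin n) → f i ≡ a

sizeA : ∀ {n m} → (Fin n → Fin m) → Fin m → ℕ
sizeA {n} f a = length (filter (λ i → f i ≟ a) (allFin n))

sizeX : ∀ {n m} → (Fin n → Fin m) → Fin n → ℕ
sizeX f i = sizeA f (f i)

-- Boltzmann entropy S = ln |·| is strictly monotone in |·|, so
-- S(x) < S(y) iff |x| < |y| and S(x) = S(y) iff |x| = |y|.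
-- D, I, C as lists of microstates (each listed once).
Dset : ∀ {n m} → (Fin n → Fin m) → (Fin n → Fin n) → List (Fin n)
Dset {n} f α = filter (λ i → sizeX f (α i) <? sizeX f i) (allFin n)

Iset : ∀ {n m} → (Fin n → Fin m) → (Fin n → Fin n) → List (Fin n)
Iset {n} f α = filter (λ i → sizeX f i <? sizeX f (α i)) (allFin n)

Cset : ∀ {n m} → (Fin n → Fin m) → (Fin n → Fin n) → List (Fin n)
Cset {n} f α = filter (λ i → sizeX f (α i) ℕ.≟ sizeX f i) (allFin n)

prob : ∀ {n m} → (Fin n → Fin m) → Fin m → ℚ
prob {n} f a = frac (sizeA f a) n

trans : ∀ {n m} → (Fin n → Fin m) → (Fin n → Fin n) → Fin m → Fin m → ℚ
trans {n} f α a b =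
  frac (length (filter (λ i → (f i ≟ b) ×-dec (f (α i) ≟ a)) (allFin n))) (sizeA f b)

pairs : ∀ m → List (Fin m × Fin m)
pairs m = cartesianProduct (allFin m) (allFin m)

term : ∀ {n m} → (Fin n → Fin m) → (Fin n → Fin n) → Fin m × Fin m → ℚ
term f α ab = trans f α (proj₁ ab) (proj₂ ab) * prob f (proj₂ ab)

sumLt : ∀ {n m} → (Fin n → Fin m) → (Fin n → Fin n) → ℚ
sumLt {n} {m} f α = sumℚ (map (term f α)
  (filter (λ ab → sizeA f (proj₁ ab) <? sizeA f (proj₂ ab)) (pairs m)))

sumGt : ∀ {n m} → (Fin n → Fin m) → (Fin n → Fin n) → ℚ
sumGt {n} {m} f α = sumℚ (map (term f α)
  (filter (λ ab → sizeA f (proj₂ ab) <? sizeA f (proj₁ ab)) (pairs m)))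

sumEq : ∀ {n m} → (Fin n → Fin m) → (Fin n → Fin n) → ℚ
sumEq {n} {m} f α = sumℚ (map (term f α)
  (filter (λ ab → sizeA f (proj₁ ab) ℕ.≟ sizeA f (proj₂ ab)) (pairs m)))

sizeAlt : ∀ {n m} → (Fin n → Fin m) → Fin m → ℕ
sizeAlt {n} {m} f b = length (filter (λ a → sizeA f a <? sizeA f b) (allFin m))

L1 : ∀ {n m} → (Fin n → Fin m) → (Fin n → Fin n) → ℚ → Set
L1 {n} f α ε = frac (length (Dset f α)) n ≤ ε

module Submission where

-- Write N(a,b) = |{i : f i = b, f (α i) = a}| for the number of
-- microstates of b that α sends into a.  Whenever |b| > 0 (always, since f is
-- surjective) the summand T_ab p_b = (N(a,b)/|b|)(|b|/|X|) is just N(a,b)/|X|.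
-- Hence for ANY decidable relation Q between macrostates,
--   Σ_{Q(a,b)} T_ab p_b = Σ_{Q(a,b)} N(a,b)/|X| = |{i : Q(f(α i), f i)}| / |X|,
-- the last step being a double count: every microstate i is counted exactly
-- once, namely in the pair (a,b) = (f(α i), f i).  Taking for Q the relations
-- |a| < |b|, |a| > |b|, |a| = |b| gives D, I, C and proves (1); (2) is then
-- immediate.  For (3) bound the summands and exchange the order of summation:
--   Σ_{|a|<|b|} T_ab p_b ≤ Σ_b |A_{<b}| · (ε/|A_{<b}|) p_b ≤ ε Σ_b p_b ≤ ε.

open import Defs
open import Data.Nat using (ℕ; _<_)
open import Data.Rational using (ℚ; 0ℚ; 1ℚ; _≤_)
open import Data.Fin using (Fin)
open import Data.List using (length)
open import Data.Product using (_×_)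
open import Function.Bundles using (_⇔_)
open import Relation.Binary.PropositionalEquality using (_≡_)

open import Data.Nat as ℕ using (zero; suc)
open import Data.Integer as ℤ using () renaming (+_ to pos)
import Data.Integer.Properties as ℤP
import Data.Nat.Properties as ℕP
open import Data.Rational as ℚ using (toℚᵘ; _+_; _*_; NonNegative)
open import Data.Rational.Properties
import Data.Rational.Unnormalised as ℚᵘ
import Data.Rational.Unnormalised.Properties as ℚᵘP
open import Data.Rational.Solver using (module +-*-Solver)
open import Data.List using (List; []; _∷_; map; filter; _++_; allFin; tabulate; cartesianProduct)
open import Data.List.Membership.Propositional using (_∈_)
open import Data.List.Membership.Propositional.Properties using (∈-allFin; ∈-filter⁺)
open import Data.List.Properties using (length-tabulate)
import Data.Fin as Fin
open import Data.Fin.Properties using () renaming (_≟_ to _≟ᶠ_)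
open import Data.Product using (_,_; proj₁; proj₂; ∃)
open import Data.Bool using (true; false)
open import Relation.Nullary using (Dec; yes; no; _because_)
open import Relation.Nullary.Decidable using (_×-dec_)
open import Relation.Unary using (Pred; Decidable)
open import Function.Bundles using (mk⇔)
open import Relation.Binary.PropositionalEquality
  using (refl; sym; cong; cong₂; subst; module ≡-Reasoning)
  renaming (trans to ≡-trans)

open +-*-Solver using (solve; _:+_; _:*_; _:=_)

⟦_⟧ : ℕ → ℚ
⟦ k ⟧ = pos k ℚ./ 1

-- Equations in ℚ are proved by passing to unnormalised rationals ℚᵘ, where
-- ⟦ k ⟧ and frac k (suc d) become literally k/1 and k/(d+1).
⟦⟧-ᵘ : ∀ k → toℚᵘ ⟦ k ⟧ ℚᵘ.≃ ℚᵘ.mkℚᵘ (pos k) 0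
⟦⟧-ᵘ k = toℚᵘ-fromℚᵘ (ℚᵘ.mkℚᵘ (pos k) 0)

frac-ᵘ : ∀ k d → toℚᵘ (frac k (suc d)) ℚᵘ.≃ ℚᵘ.mkℚᵘ (pos k) d
frac-ᵘ k d = toℚᵘ-fromℚᵘ (ℚᵘ.mkℚᵘ (pos k) d)

⟦suc⟧ : ∀ k → ⟦ suc k ⟧ ≡ 1ℚ + ⟦ k ⟧
⟦suc⟧ k = toℚᵘ-injective (begin
    toℚᵘ ⟦ suc k ⟧                    ≈⟨ ⟦⟧-ᵘ (suc k) ⟩
    ℚᵘ.mkℚᵘ (pos (suc k)) 0           ≈⟨ ℚᵘ.*≡* numerators ⟩
    ℚᵘ.1ℚᵘ ℚᵘ.+ ℚᵘ.mkℚᵘ (pos k) 0     ≈⟨ ℚᵘP.≃-sym (ℚᵘP.+-congʳ ℚᵘ.1ℚᵘ (⟦⟧-ᵘ k)) ⟩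
    toℚᵘ 1ℚ ℚᵘ.+ toℚᵘ ⟦ k ⟧           ≈⟨ ℚᵘP.≃-sym (toℚᵘ-homo-+ 1ℚ ⟦ k ⟧) ⟩
    toℚᵘ (1ℚ + ⟦ k ⟧)                 ∎)
  where
  open ℚᵘP.≃-Reasoning
  numerators : pos (suc k) ℤ.* pos 1 ≡ (pos 1 ℤ.* pos 1 ℤ.+ pos k ℤ.* pos 1) ℤ.* pos 1
  numerators = cong (ℤ._* pos 1) (cong (ℤ._+_ (pos 1)) (sym (ℤP.*-identityʳ (pos k))))

-- k/d = k · (1/d); for d = 0 both sides are the junk value 0.
frac-split : ∀ k d → frac k d ≡ ⟦ k ⟧ * frac 1 d
frac-split k zero    = sym (*-zeroʳ ⟦ k ⟧)
frac-split k (suc d) = toℚᵘ-injective (begin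
    toℚᵘ (frac k (suc d))                   ≈⟨ frac-ᵘ k d ⟩
    ℚᵘ.mkℚᵘ (pos k) d                       ≈⟨ ℚᵘ.*≡* cross ⟩
    ℚᵘ.mkℚᵘ (pos k) 0 ℚᵘ.* ℚᵘ.mkℚᵘ (pos 1) d  ≈⟨ ℚᵘP.≃-sym (ℚᵘP.*-cong (⟦⟧-ᵘ k) (frac-ᵘ 1 d)) ⟩
    toℚᵘ ⟦ k ⟧ ℚᵘ.* toℚᵘ (frac 1 (suc d))   ≈⟨ ℚᵘP.≃-sym (toℚᵘ-homo-* ⟦ k ⟧ (frac 1 (suc d))) ⟩
    toℚᵘ (⟦ k ⟧ * frac 1 (suc d))           ∎)
  where
  open ℚᵘP.≃-Reasoning
  cross : pos k ℤ.* pos (suc (d ℕ.+ 0)) ≡ (pos k ℤ.* pos 1) ℤ.* pos (suc d)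
  cross rewrite ℕP.+-identityʳ d | ℤP.*-identityʳ (pos k) = refl

⟦⟧-inverse : ∀ d → ⟦ suc d ⟧ * frac 1 (suc d) ≡ 1ℚ
⟦⟧-inverse d = sym (≡-trans one-as-frac (frac-split (suc d) (suc d)))
  where
  same : pos (suc d) ℤ.* pos 1 ≡ pos 1 ℤ.* pos (suc d)
  same = ≡-trans (ℤP.*-identityʳ (pos (suc d))) (sym (ℤP.*-identityˡ (pos (suc d))))
  one-as-frac : 1ℚ ≡ frac (suc d) (suc d)
  one-as-frac = toℚᵘ-injective (ℚᵘP.≃-sym (ℚᵘP.≃-trans (frac-ᵘ (suc d) d) (ℚᵘ.*≡* same)))

-- Cancellation (x/d)(d/n) = x/n for d ≠ 0; it turns T_ab p_b into N(a,b)/|X|.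
frac-cancel : ∀ x k n → frac x (suc k) * frac (suc k) n ≡ frac x n
frac-cancel x k n = begin
    frac x (suc k) * frac (suc k) n
  ≡⟨ cong₂ _*_ (frac-split x (suc k)) (frac-split (suc k) n) ⟩
    (⟦ x ⟧ * u) * (⟦ suc k ⟧ * r)
  ≡⟨ solve 4 (λ a b c d → (a :* b) :* (c :* d) := (a :* d) :* (c :* b)) refl ⟦ x ⟧ u ⟦ suc k ⟧ r ⟩
    (⟦ x ⟧ * r) * (⟦ suc k ⟧ * u)
  ≡⟨ cong ((⟦ x ⟧ * r) *_) (⟦⟧-inverse k) ⟩
    (⟦ x ⟧ * r) * 1ℚ
  ≡⟨ *-identityʳ _ ⟩
    ⟦ x ⟧ * r
  ≡⟨ sym (frac-split x n) ⟩
    frac x n ∎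
  where
  open ≡-Reasoning
  u r : ℚ
  u = frac 1 (suc k)
  r = frac 1 n

frac-nonNeg : ∀ k d → NonNegative (frac k d)
frac-nonNeg k zero    = _
frac-nonNeg k (suc d) = normalize-nonNeg k (suc d)

-- n/n ≤ 1 (it is 1, except for the junk value 0/0 = 0).
frac-self-≤1 : ∀ n → frac n n ≤ 1ℚ
frac-self-≤1 zero    = nonNegative⁻¹ 1ℚ
frac-self-≤1 (suc d) = ≤-reflexive (≡-trans (frac-split (suc d) (suc d)) (⟦⟧-inverse d))

-- c · (ε/c) ≤ ε: c copies of ε/c add up to at most ε (for c = 0 the sum is 0).
⟦⟧-divℕ : ∀ ε → 0ℚ ≤ ε → ∀ c → ⟦ c ⟧ * divℕ ε c ≤ ε
⟦⟧-divℕ ε 0≤ε zero    = 0≤ε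
⟦⟧-divℕ ε 0≤ε (suc k) = ≤-reflexive (begin
    ⟦ suc k ⟧ * (ε * frac 1 (suc k))
  ≡⟨ solve 3 (λ c e u → c :* (e :* u) := e :* (c :* u)) refl ⟦ suc k ⟧ ε (frac 1 (suc k)) ⟩
    ε * (⟦ suc k ⟧ * frac 1 (suc k))
  ≡⟨ cong (ε *_) (⟦⟧-inverse k) ⟩
    ε * 1ℚ
  ≡⟨ *-identityʳ ε ⟩
    ε ∎)
  where open ≡-Reasoning

∑ : ∀ {a} {A : Set a} → List A → (A → ℚ) → ℚ
∑ L g = sumℚ (map g L)

𝟙 : ∀ {p} {P : Set p} → Dec P → ℚ
𝟙 (true  because _) = 1ℚ
𝟙 (false because _) = 0ℚ

𝟙-× : ∀ {p r} {P : Set p} {R : Set r} (d : Dec P) (e : Dec R) → 𝟙 (d ×-dec e) ≡ 𝟙 d * 𝟙 e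
𝟙-× (true  because _) (true  because _) = refl
𝟙-× (true  because _) (false because _) = refl
𝟙-× (false because _) (true  because _) = refl
𝟙-× (false because _) (false because _) = refl

module _ {a} {A : Set a} where

  ∑-cong : ∀ (L : List A) {g h : A → ℚ} → (∀ x → g x ≡ h x) → ∑ L g ≡ ∑ L h
  ∑-cong []      g≡h = refl
  ∑-cong (x ∷ L) g≡h = cong₂ _+_ (g≡h x) (∑-cong L g≡h)

  ∑-mono : ∀ (L : List A) {g h : A → ℚ} → (∀ x → g x ≤ h x) → ∑ L g ≤ ∑ L h
  ∑-mono []      g≤h = ≤-refl
  ∑-mono (x ∷ L) g≤h = +-mono-≤ (g≤h x) (∑-mono L g≤h)

  ∑-zero : ∀ (L : List A) → ∑ L (λ _ → 0ℚ) ≡ 0ℚ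
  ∑-zero []      = refl
  ∑-zero (x ∷ L) = ≡-trans (+-identityˡ _) (∑-zero L)

  ∑-+ : ∀ (L : List A) (g h : A → ℚ) → ∑ L (λ x → g x + h x) ≡ ∑ L g + ∑ L h
  ∑-+ []      g h = refl
  ∑-+ (x ∷ L) g h = ≡-trans (cong ((g x + h x) +_) (∑-+ L g h))
    (solve 4 (λ a b c d → (a :+ b) :+ (c :+ d) := (a :+ c) :+ (b :+ d)) refl (g x) (h x) (∑ L g) (∑ L h))

  ∑-*ˡ : ∀ (L : List A) (c : ℚ) (g : A → ℚ) → ∑ L (λ x → c * g x) ≡ c * ∑ L g
  ∑-*ˡ []      c g = sym (*-zeroʳ c)
  ∑-*ˡ (x ∷ L) c g = ≡-trans (cong (c * g x +_) (∑-*ˡ L c g)) (sym (*-distribˡ-+ c (g x) (∑ L g)))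

  ∑-*ʳ : ∀ (L : List A) (c : ℚ) (g : A → ℚ) → ∑ L (λ x → g x * c) ≡ ∑ L g * c
  ∑-*ʳ L c g = ≡-trans (∑-cong L (λ x → *-comm (g x) c)) (≡-trans (∑-*ˡ L c g) (*-comm c (∑ L g)))

  ∑-++ : ∀ (xs ys : List A) (g : A → ℚ) → ∑ (xs ++ ys) g ≡ ∑ xs g + ∑ ys g
  ∑-++ []       ys g = sym (+-identityˡ _)
  ∑-++ (x ∷ xs) ys g = ≡-trans (cong (g x +_) (∑-++ xs ys g)) (sym (+-assoc (g x) (∑ xs g) (∑ ys g)))

  ∑-filter : ∀ {p} {P : Pred A p} (Q : Decidable P) (L : List A) (g : A → ℚ) →
             ∑ (filter Q L) g ≡ ∑ L (λ x → 𝟙 (Q x) * g x)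
  ∑-filter Q []      g = refl
  ∑-filter Q (x ∷ L) g with Q x
  ... | true  because _ = cong₂ _+_ (sym (*-identityˡ (g x))) (∑-filter Q L g)
  ... | false because _ = ≡-trans (∑-filter Q L g)
                            (≡-trans (sym (+-identityˡ _)) (cong (_+ _) (sym (*-zeroˡ (g x)))))

  ∑-count : ∀ {p} {P : Pred A p} (Q : Decidable P) (L : List A) →
            ∑ L (λ x → 𝟙 (Q x)) ≡ ⟦ length (filter Q L) ⟧
  ∑-count Q []      = refl
  ∑-count Q (x ∷ L) with Q x
  ... | true  because _ = ≡-trans (cong (1ℚ +_) (∑-count Q L)) (sym (⟦suc⟧ (length (filter Q L))))
  ... | false because _ = ≡-trans (+-identityˡ _) (∑-count Q L)

  ∑-one : ∀ (L : List A) → ∑ L (λ _ → 1ℚ) ≡ ⟦ length L ⟧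
  ∑-one []      = refl
  ∑-one (x ∷ L) = ≡-trans (cong (1ℚ +_) (∑-one L)) (sym (⟦suc⟧ (length L)))

∑-map : ∀ {a b} {A : Set a} {B : Set b} (k : A → B) (L : List A) (g : B → ℚ) →
        ∑ (map k L) g ≡ ∑ L (λ x → g (k x))
∑-map k []      g = refl
∑-map k (x ∷ L) g = cong (g (k x) +_) (∑-map k L g)

module _ {a b} {A : Set a} {B : Set b} where

  ∑-swap : ∀ (L : List A) (M : List B) (h : A → B → ℚ) →
           ∑ L (λ x → ∑ M (h x)) ≡ ∑ M (λ y → ∑ L (λ x → h x y))
  ∑-swap []      M h = sym (∑-zero M)
  ∑-swap (x ∷ L) M h = ≡-trans (cong (∑ M (h x) +_) (∑-swap L M h))
                                (sym (∑-+ M (h x) (λ y → ∑ L (λ x′ → h x′ y))))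

  ∑-pairs : ∀ (xs : List A) (ys : List B) (g : A × B → ℚ) →
            ∑ (cartesianProduct xs ys) g ≡ ∑ xs (λ x → ∑ ys (λ y → g (x , y)))
  ∑-pairs []       ys g = refl
  ∑-pairs (x ∷ xs) ys g = ≡-trans (∑-++ (map (x ,_) ys) _ g)
                                  (cong₂ _+_ (∑-map (x ,_) ys g) (∑-pairs xs ys g))

∑-tabulate : ∀ {a} {A : Set a} m (k : Fin m → A) (g : A → ℚ) →
             ∑ (tabulate k) g ≡ ∑ (allFin m) (λ i → g (k i))
∑-tabulate zero    k g = refl
∑-tabulate (suc m) k g = cong (g (k Fin.zero) +_)
  (≡-trans (∑-tabulate m (λ i → k (Fin.suc i)) g) (sym (∑-tabulate m Fin.suc (λ i → g (k i)))))

𝟙-suc : ∀ {m} (c b : Fin m) → 𝟙 (Fin.suc c ≟ᶠ Fin.suc b) ≡ 𝟙 (c ≟ᶠ b)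
𝟙-suc c b with c ≟ᶠ b
... | true  because _ = refl
... | false because _ = refl

∑-delta : ∀ m (c : Fin m) (g : Fin m → ℚ) → ∑ (allFin m) (λ b → 𝟙 (c ≟ᶠ b) * g b) ≡ g c
∑-delta (suc m) Fin.zero g = ≡-trans
  (cong₂ _+_ (*-identityˡ (g Fin.zero))
    (≡-trans (∑-tabulate m Fin.suc (λ b → 𝟙 (Fin.zero ≟ᶠ b) * g b))
      (≡-trans (∑-cong (allFin m) (λ b → *-zeroˡ (g (Fin.suc b)))) (∑-zero (allFin m)))))
  (+-identityʳ (g Fin.zero))
∑-delta (suc m) (Fin.suc c) g = ≡-trans
  (cong₂ _+_ (*-zeroˡ (g Fin.zero))
    (≡-trans (∑-tabulate m Fin.suc (λ b → 𝟙 (Fin.suc c ≟ᶠ b) * g b))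
      (≡-trans (∑-cong (allFin m) (λ b → cong (_* g (Fin.suc b)) (𝟙-suc c b)))
        (∑-delta m c (λ b → g (Fin.suc b))))))
  (+-identityˡ (g (Fin.suc c)))

∑-delta-pairs : ∀ m (c d : Fin m) (h : Fin m × Fin m → ℚ) →
  ∑ (pairs m) (λ p → (𝟙 (d ≟ᶠ proj₂ p) * 𝟙 (c ≟ᶠ proj₁ p)) * h p) ≡ h (c , d)
∑-delta-pairs m c d h = begin
    ∑ (pairs m) (λ p → (𝟙 (d ≟ᶠ proj₂ p) * 𝟙 (c ≟ᶠ proj₁ p)) * h p)
  ≡⟨ ∑-pairs (allFin m) (allFin m) _ ⟩
    ∑ (allFin m) (λ a → ∑ (allFin m) (λ b → (𝟙 (d ≟ᶠ b) * 𝟙 (c ≟ᶠ a)) * h (a , b)))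
  ≡⟨ ∑-cong (allFin m) (λ a → ∑-cong (allFin m) (λ b → *-assoc (𝟙 (d ≟ᶠ b)) (𝟙 (c ≟ᶠ a)) (h (a , b)))) ⟩
    ∑ (allFin m) (λ a → ∑ (allFin m) (λ b → 𝟙 (d ≟ᶠ b) * (𝟙 (c ≟ᶠ a) * h (a , b))))
  ≡⟨ ∑-cong (allFin m) (λ a → ∑-delta m d (λ b → 𝟙 (c ≟ᶠ a) * h (a , b))) ⟩
    ∑ (allFin m) (λ a → 𝟙 (c ≟ᶠ a) * h (a , d))
  ≡⟨ ∑-delta m c (λ a → h (a , d)) ⟩
    h (c , d) ∎
  where open ≡-Reasoning

∈⇒length-suc : ∀ {a} {A : Set a} {x : A} {L : List A} → x ∈ L → ∃ λ k → length L ≡ suc k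
∈⇒length-suc {L = _ ∷ L} _ = length L , refl

module DoubleCounting {n m : ℕ} (f : Fin n → Fin m) (α : Fin n → Fin n) where

  flow : Fin m × Fin m → ℕ
  flow p = length (filter (λ i → (f i ≟ᶠ proj₂ p) ×-dec (f (α i) ≟ᶠ proj₁ p)) (allFin n))

  fibre-nonempty : Surjective f → ∀ b → ∃ λ k → sizeA f b ≡ suc k
  fibre-nonempty surj b =
    ∈⇒length-suc (∈-filter⁺ (λ i → f i ≟ᶠ b) (∈-allFin (proj₁ (surj b))) (proj₂ (surj b)))

  term-flow : Surjective f → ∀ p → term f α p ≡ frac (flow p) n
  term-flow surj (a , b) with sizeA f b | fibre-nonempty surj b
  ... | .(suc k) | k , refl = frac-cancel (flow (a , b)) k n

  -- Σ_{Q(a,b)} N(a,b) = |{i : Q(f(α i), f i)}|: microstate i is counted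
  -- only in the pair (f(α i), f i).
  flow-count : ∀ {ℓ} {P : Pred (Fin m × Fin m) ℓ} (Q : Decidable P) →
    ∑ (filter Q (pairs m)) (λ p → ⟦ flow p ⟧) ≡ ⟦ length (filter (λ i → Q (f (α i) , f i)) (allFin n)) ⟧
  flow-count Q = begin
      ∑ (filter Q (pairs m)) (λ p → ⟦ flow p ⟧)
    ≡⟨ ∑-filter Q (pairs m) _ ⟩
      ∑ (pairs m) (λ p → 𝟙 (Q p) * ⟦ flow p ⟧)
    ≡⟨ ∑-cong (pairs m) (λ p → cong (𝟙 (Q p) *_) (flow-as-sum p)) ⟩
      ∑ (pairs m) (λ p → 𝟙 (Q p) * ∑ (allFin n) (λ i → H i p))
    ≡⟨ ∑-cong (pairs m) (λ p → sym (∑-*ˡ (allFin n) (𝟙 (Q p)) (λ i → H i p))) ⟩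
      ∑ (pairs m) (λ p → ∑ (allFin n) (λ i → 𝟙 (Q p) * H i p))
    ≡⟨ ∑-swap (pairs m) (allFin n) (λ p i → 𝟙 (Q p) * H i p) ⟩
      ∑ (allFin n) (λ i → ∑ (pairs m) (λ p → 𝟙 (Q p) * H i p))
    ≡⟨ ∑-cong (allFin n) (λ i → ≡-trans (∑-cong (pairs m) (λ p → *-comm (𝟙 (Q p)) (H i p)))
                                          (∑-delta-pairs m (f (α i)) (f i) (λ p → 𝟙 (Q p)))) ⟩
      ∑ (allFin n) (λ i → 𝟙 (Q (f (α i) , f i)))
    ≡⟨ ∑-count (λ i → Q (f (α i) , f i)) (allFin n) ⟩
      ⟦ length (filter (λ i → Q (f (α i) , f i)) (allFin n)) ⟧ ∎
    where
    open ≡-Reasoning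
    H : Fin n → Fin m × Fin m → ℚ
    H i p = 𝟙 (f i ≟ᶠ proj₂ p) * 𝟙 (f (α i) ≟ᶠ proj₁ p)
    flow-as-sum : ∀ p → ⟦ flow p ⟧ ≡ ∑ (allFin n) (λ i → H i p)
    flow-as-sum p = ≡-trans (sym (∑-count _ (allFin n)))
      (∑-cong (allFin n) (λ i → 𝟙-× (f i ≟ᶠ proj₂ p) (f (α i) ≟ᶠ proj₁ p)))

  transition-sum : Surjective f → ∀ {ℓ} {P : Pred (Fin m × Fin m) ℓ} (Q : Decidable P) →
    frac (length (filter (λ i → Q (f (α i) , f i)) (allFin n))) n ≡ sumℚ (map (term f α) (filter Q (pairs m)))
  transition-sum surj Q = sym (begin
      ∑ (filter Q (pairs m)) (term f α)
    ≡⟨ ∑-cong (filter Q (pairs m)) (λ p → ≡-trans (term-flow surj p) (frac-split (flow p) n)) ⟩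
      ∑ (filter Q (pairs m)) (λ p → ⟦ flow p ⟧ * frac 1 n)
    ≡⟨ ∑-*ʳ (filter Q (pairs m)) (frac 1 n) (λ p → ⟦ flow p ⟧) ⟩
      ∑ (filter Q (pairs m)) (λ p → ⟦ flow p ⟧) * frac 1 n
    ≡⟨ cong (_* frac 1 n) (flow-count Q) ⟩
      ⟦ length (filter (λ i → Q (f (α i) , f i)) (allFin n)) ⟧ * frac 1 n
    ≡⟨ sym (frac-split _ n) ⟩
      frac (length (filter (λ i → Q (f (α i) , f i)) (allFin n))) n ∎)
    where open ≡-Reasoning

module TransitionBound {n m : ℕ} (f : Fin n → Fin m) (α : Fin n → Fin n) where

  fibre-sizes : ∑ (allFin m) (λ b → ⟦ sizeA f b ⟧) ≡ ⟦ n ⟧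
  fibre-sizes = begin
      ∑ (allFin m) (λ b → ⟦ sizeA f b ⟧)
    ≡⟨ ∑-cong (allFin m) (λ b → sym (∑-count (λ i → f i ≟ᶠ b) (allFin n))) ⟩
      ∑ (allFin m) (λ b → ∑ (allFin n) (λ i → 𝟙 (f i ≟ᶠ b)))
    ≡⟨ ∑-swap (allFin m) (allFin n) (λ b i → 𝟙 (f i ≟ᶠ b)) ⟩
      ∑ (allFin n) (λ i → ∑ (allFin m) (λ b → 𝟙 (f i ≟ᶠ b)))
    ≡⟨ ∑-cong (allFin n) (λ i → ≡-trans (∑-cong (allFin m) (λ b → sym (*-identityʳ (𝟙 (f i ≟ᶠ b)))))
                                          (∑-delta m (f i) (λ _ → 1ℚ))) ⟩
      ∑ (allFin n) (λ _ → 1ℚ)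
    ≡⟨ ∑-one (allFin n) ⟩
      ⟦ length (allFin n) ⟧
    ≡⟨ cong ⟦_⟧ (length-tabulate {n = n} (λ i → i)) ⟩
      ⟦ n ⟧ ∎
    where open ≡-Reasoning

  total-probability : ∑ (allFin m) (prob f) ≤ 1ℚ
  total-probability = begin
      ∑ (allFin m) (prob f)
    ≡⟨ ∑-cong (allFin m) (λ b → frac-split (sizeA f b) n) ⟩
      ∑ (allFin m) (λ b → ⟦ sizeA f b ⟧ * frac 1 n)
    ≡⟨ ∑-*ʳ (allFin m) (frac 1 n) (λ b → ⟦ sizeA f b ⟧) ⟩
      ∑ (allFin m) (λ b → ⟦ sizeA f b ⟧) * frac 1 n
    ≡⟨ cong (_* frac 1 n) fibre-sizes ⟩
      ⟦ n ⟧ * frac 1 n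
    ≡⟨ sym (frac-split n n) ⟩
      frac n n
    ≤⟨ frac-self-≤1 n ⟩
      1ℚ ∎
    where open ≤-Reasoning

  decLt : (p : Fin m × Fin m) → Dec (sizeA f (proj₁ p) < sizeA f (proj₂ p))
  decLt p = sizeA f (proj₁ p) ℕ.<? sizeA f (proj₂ p)

  sumLt-bound : ∀ ε → 0ℚ ≤ ε →
    (∀ (a b : Fin m) → sizeA f a < sizeA f b → trans f α a b ≤ divℕ ε (sizeAlt f b)) →
    sumLt f α ≤ ε
  sumLt-bound ε 0≤ε small = begin
      sumLt f α
    ≡⟨ ∑-filter decLt (pairs m) (term f α) ⟩
      ∑ (pairs m) (λ p → 𝟙 (decLt p) * term f α p)
    ≤⟨ ∑-mono (pairs m) term-bound ⟩
      ∑ (pairs m) (λ p → 𝟙 (decLt p) * share (proj₂ p))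
    ≡⟨ ∑-pairs (allFin m) (allFin m) _ ⟩
      ∑ (allFin m) (λ a → ∑ (allFin m) (λ b → 𝟙 (decLt (a , b)) * share b))
    ≡⟨ ∑-swap (allFin m) (allFin m) (λ a b → 𝟙 (decLt (a , b)) * share b) ⟩
      ∑ (allFin m) (λ b → ∑ (allFin m) (λ a → 𝟙 (decLt (a , b)) * share b))
    ≡⟨ ∑-cong (allFin m) (λ b → ≡-trans (∑-*ʳ (allFin m) (share b) (λ a → 𝟙 (decLt (a , b))))
                                         (cong (_* share b) (∑-count (λ a → decLt (a , b)) (allFin m)))) ⟩
      ∑ (allFin m) (λ b → ⟦ sizeAlt f b ⟧ * share b)
    ≤⟨ ∑-mono (allFin m) shares-bound ⟩
      ∑ (allFin m) (λ b → ε * prob f b)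
    ≡⟨ ∑-*ˡ (allFin m) ε (prob f) ⟩
      ε * ∑ (allFin m) (prob f)
    ≤⟨ *-monoˡ-≤-nonNeg ε {{ℚ.nonNegative 0≤ε}} total-probability ⟩
      ε * 1ℚ
    ≡⟨ *-identityʳ ε ⟩
      ε ∎
    where
    open ≤-Reasoning
    -- The bound (ε/|A_{<b}|) p_b on each summand T_ab p_b with |a| < |b|.
    share : Fin m → ℚ
    share b = divℕ ε (sizeAlt f b) * prob f b
    instance
      prob-nonNeg : ∀ {b} → NonNegative (prob f b)
      prob-nonNeg {b} = frac-nonNeg (sizeA f b) n
    term-bound : ∀ p → 𝟙 (decLt p) * term f α p ≤ 𝟙 (decLt p) * share (proj₂ p)
    term-bound (a , b) with decLt (a , b)
    ... | yes lt = *-monoˡ-≤-nonNeg 1ℚ (*-monoʳ-≤-nonNeg (prob f b) (small a b lt))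
    ... | no  _  = ≤-reflexive (≡-trans (*-zeroˡ (term f α (a , b))) (sym (*-zeroˡ (share b))))
    shares-bound : ∀ b → ⟦ sizeAlt f b ⟧ * share b ≤ ε * prob f b
    shares-bound b = begin
        ⟦ sizeAlt f b ⟧ * (divℕ ε (sizeAlt f b) * prob f b)
      ≡⟨ sym (*-assoc ⟦ sizeAlt f b ⟧ (divℕ ε (sizeAlt f b)) (prob f b)) ⟩
        (⟦ sizeAlt f b ⟧ * divℕ ε (sizeAlt f b)) * prob f b
      ≤⟨ *-monoʳ-≤-nonNeg (prob f b) (⟦⟧-divℕ ε 0≤ε (sizeAlt f b)) ⟩
        ε * prob f b ∎

mainTheorem1 : ∀ {n m : ℕ} (f : Fin n → Fin m) (α : Fin n → Fin n) → Surjective f →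
    ((frac (length (Dset f α)) n ≡ sumLt f α)
      × (frac (length (Iset f α)) n ≡ sumGt f α)
      × (frac (length (Cset f α)) n ≡ sumEq f α))
    × (∀ (ε : ℚ) → 0ℚ ≤ ε → ε ≤ 1ℚ → (L1 f α ε ⇔ (sumLt f α ≤ ε)))
    × (∀ (ε : ℚ) → 0ℚ ≤ ε → ε ≤ 1ℚ →
         (∀ (a b : Fin m) → sizeA f a < sizeA f b → trans f α a b ≤ divℕ ε (sizeAlt f b)) →
         L1 f α ε)
mainTheorem1 {n} f α surj =
    (D≡sumLt , I≡sumGt , C≡sumEq)
  , (λ ε _ _ → mk⇔ (subst (_≤ ε) D≡sumLt) (subst (_≤ ε) (sym D≡sumLt)))
  , (λ ε 0≤ε _ small → subst (_≤ ε) (sym D≡sumLt) (sumLt-bound ε 0≤ε small))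
  where
  open DoubleCounting f α using (transition-sum)
  open TransitionBound f α using (sumLt-bound)
  D≡sumLt : frac (length (Dset f α)) n ≡ sumLt f α
  D≡sumLt = transition-sum surj (λ p → sizeA f (proj₁ p) ℕ.<? sizeA f (proj₂ p))
  I≡sumGt : frac (length (Iset f α)) n ≡ sumGt f α
  I≡sumGt = transition-sum surj (λ p → sizeA f (proj₂ p) ℕ.<? sizeA f (proj₁ p))
  C≡sumEq : frac (length (Cset f α)) n ≡ sumEq f α
  C≡sumEq = transition-sum surj (λ p → sizeA f (proj₁ p) ℕ.≟ sizeA f (proj₂ p))
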